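{- Let $n\ge 1$, let $w=w_1w_2\cdots w_n$ be a word of length $n$ over the alphabet $\mathbb{Z}_+$ of positive integers, and let $k\in\mathbb{Z}_{\ge 0}$. Then \[ \operatorname{inv}^k(w)=\operatorname{inv}^{k+1}(B_{k+1}(w)). \]
   Context: Let $W_n$ be the set of words of length $n$ over $\mathbb{Z}_+$, and write $w_i$ for the $i$-th letter of $w$. For $k\in\mathbb{Z}_{\ge0}$, a relative $k$-inversion of $w\in W_n$ is a pair $(i,j)$ with $i<j$ such that either $k\ge w_i>w_j$, or $w_i>w_j>k$, or $w_j>k\ge w_i$. Let $\operatorname{inv}^k(w)$ be the number of $k$-inversions of $w$ (so $\operatorname{inv}^0$ is the usual inversion number). For $i\in\mathbb{Z}_+$, the basement lift map $B_i:W_n\to W_n$ is defined by: $(B_i(w))_j=i$ if and only if $w_{n+1-j}=i$, and the subword of $w$ consisting of all letters not equal to $i$ equals the subword of $B_i(w)$ consisting of all letters not equal to $i$. (That is, the positions of the letters $i$ are reflected and the other letters keep their relative order.) -}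

module Defs where

open import Data.Nat using (ℕ; zero; suc; _+_; _≤_; _<_; _≤?_; _<?_; _≟_)
open import Data.Fin using (Fin; opposite)
open import Data.Fin.Properties using (all?)
open import Data.List using (List; []; _∷_; filter; length; reverse)
open import Data.List.Membership.Propositional using (_∈_)
open import Data.Vec using (Vec; []; _∷_; lookup; toList; fromList)
open import Data.Product using (_×_; _,_)
open import Data.Sum using (_⊎_)
open import Relation.Nullary using (Dec; yes; no; ¬_)
open import Relation.Nullary.Decidable using (_×-dec_; _⊎-dec_; ¬?)
open import Data.Fin using (_<_) renaming (_<?_ to _<ᶠ?_)
open import Data.Fin.Subset using (Subset)
import Data.Fin as F

Word : ℕ → Set
Word n = Vec ℕ n

IsPositiveWord : ∀ {n} → Word n → Set
IsPositiveWord {n} w = (i : Fin n) → 0 Data.Nat.< lookup w i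

KInvPair : ℕ → ℕ → ℕ → Set
KInvPair k a b =
  (a ≤ k × b Data.Nat.< a) ⊎ ((b Data.Nat.< a × k Data.Nat.< b) ⊎ (k Data.Nat.< b × a ≤ k))

kInvPair? : ∀ k a b → Dec (KInvPair k a b)
kInvPair? k a b =
  ((a ≤? k) ×-dec (b <? a)) ⊎-dec (((b <? a) ×-dec (k <? b)) ⊎-dec ((k <? b) ×-dec (a ≤? k)))

count : ∀ {n} {P : Fin n → Set} → ((i : Fin n) → Dec (P i)) → ℕ
count {zero} P? = 0
count {suc n} P? with P? F.zero
... | yes _ = suc (count (λ i → P? (F.suc i)))
... | no _ = count (λ i → P? (F.suc i))

sumFin : ∀ {n} → (Fin n → ℕ) → ℕ
sumFin {zero} f = 0
sumFin {suc n} f = f F.zero + sumFin (λ i → f (F.suc i))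

inv : ℕ → ∀ {n} → Word n → ℕ
inv k {n} w =
  sumFin (λ i → count (λ j → (i <ᶠ? j) ×-dec kInvPair? k (lookup w i) (lookup w j)))

-- Basement lift B_i.  Positions j with w_{n+1-j} = i get the letter i;
-- the remaining positions are filled, left to right, by the letters of w
-- different from i, in their original order.
private
  fill : ℕ → ∀ {n} → Vec ℕ n → List ℕ → Vec ℕ n
  fill i [] rest = []
  fill i (x ∷ xs) rest with x ≟ i
  fill i (x ∷ xs) rest | yes _ = i ∷ fill i xs rest
  fill i (x ∷ xs) [] | no _ = 0 ∷ fill i xs []   -- unreachable (length mismatch)
  fill i (x ∷ xs) (r ∷ rest) | no _ = r ∷ fill i xs rest

B : ℕ → ∀ {n} → Word n → Word n
B i w = fill i (Data.Vec.reverse w) (filter (λ x → ¬? (x ≟ i)) (toList w))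

-- Let c = k + 1.  Since no letter lies strictly between k and c, a pair of letters both different
-- from c is a k-inversion iff it is a c-inversion.  A pair involving c is a k-inversion iff it reads
-- (x, c) with x ≠ c, and a c-inversion iff it reads (c, y) with y ≠ c.  So inv^k w is inv^k of the
-- subword of letters ≠ c plus the number of ascents false < true of the 0/1 pattern marking the
-- occurrences of c, and inv^c (B_c w) is the same first term plus the number of descents of the
-- pattern of B_c w.  B_c keeps the subword and reverses the pattern, exchanging ascents and descents.

module Submission where

open import Data.Nat using (ℕ; suc; _≥_)
open import Relation.Binary.PropositionalEquality using (_≡_)
open import Defs

open import Data.Bool using (Bool; true; false)
import Data.Bool as Bool
import Data.Bool.Properties as Bool
open import Data.Empty using (⊥-elim)
open import Data.Fin using (Fin) renaming (_<?_ to _<ᶠ?_)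
import Data.Fin as Fin
open import Data.List using (List; []; _∷_; [_]; _++_; _∷ʳ_; filter; length; map; reverse)
open import Data.List.Properties
  using (filter-++; length-++; filter-accept; filter-reject; filter-≐; unfold-reverse; reverse-map)
open import Data.List.Relation.Binary.Permutation.Propositional.Properties using (↭-length; filter-↭; ↭-reverse)
open import Data.List.Relation.Unary.All using (All; []; _∷_)
import Data.List.Relation.Unary.All as All
open import Data.List.Relation.Unary.All.Properties using (all-filter)
open import Data.Nat using (zero; _+_; _≤_; _≟_; _≤?_; z≤n; s≤s)
open import Data.Nat.Properties
  using (+-comm; +-suc; suc-injective; ≤-refl; <-≤-trans; 1+n≰n; n≮n; n<1+n; m≤n⇒m≤1+n; m<1+n⇒m≤n;
         <⇒≤; <⇒≱; ≰⇒>; ≤∧≢⇒<; <-cmp; +-commutativeSemigroup)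
open import Algebra.Properties.CommutativeSemigroup +-commutativeSemigroup using (interchange; x∙yz≈y∙xz)
open import Data.Product using (_,_; proj₂)
open import Data.Sum using (_⊎_; inj₁; inj₂; [_,_]′)
open import Data.Vec using (Vec; lookup; toList)
import Data.Vec as Vec
open import Data.Vec.Properties using (toList-reverse)
open import Function using (_∘_; flip; _⇔_; mk⇔; Equivalence)
open import Level using (Level; 0ℓ)
open import Relation.Binary using (Rel; Decidable; tri<; tri≈; tri>)
open import Relation.Binary.PropositionalEquality using (_≢_; refl; sym; trans; cong; cong₂; ≢-sym; module ≡-Reasoning)
open import Relation.Nullary using (yes; no; ¬_; does; contradiction; ¬?)
open import Relation.Nullary.Decidable using (_×-dec_; dec-true; dec-false)
open import Relation.Unary using (Pred) renaming (Decidable to Decidable₁)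

open Equivalence using (to; from)

private
  variable
    a b p q r s : Level
    A : Set a
    X : Set b

inversions : {R : Rel A r} → Decidable R → List A → ℕ
inversions R? []       = 0
inversions R? (x ∷ xs) = length (filter (R? x) xs) + inversions R? xs

marks : {P : Pred A p} → Decidable₁ P → List A → List Bool
marks P? = map (does ∘ P?)

module _ {P : Pred A p} (P? : Decidable₁ P) where

  length-filter-++ : ∀ xs ys → length (filter P? (xs ++ ys)) ≡ length (filter P? xs) + length (filter P? ys)
  length-filter-++ xs ys = trans (cong length (filter-++ P? xs ys)) (length-++ (filter P? xs))

  length-filter-reverse : ∀ xs → length (filter P? (reverse xs)) ≡ length (filter P? xs)
  length-filter-reverse xs = ↭-length (filter-↭ P? (↭-reverse xs))

  length-filter-map : {f : X → A} → ∀ xs → length (filter P? (map f xs)) ≡ length (filter (P? ∘ f) xs)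
  length-filter-map [] = refl
  length-filter-map {f = f} (x ∷ xs) with P? (f x)
  ... | yes _ = cong suc (length-filter-map xs)
  ... | no _  = length-filter-map xs

  length-filter-cong : {Q : Pred A q} (Q? : Decidable₁ Q) → ∀ {xs} → All (λ x → P x ⇔ Q x) xs →
    length (filter P? xs) ≡ length (filter Q? xs)
  length-filter-cong Q? [] = refl
  length-filter-cong Q? {x ∷ xs} (P⇔Q ∷ rest) with P? x | Q? x
  ... | yes _  | yes _  = cong suc (length-filter-cong Q? rest)
  ... | no _   | no _   = length-filter-cong Q? rest
  ... | yes px | no ¬qx = contradiction (to P⇔Q px) ¬qx
  ... | no ¬px | yes qx = contradiction (from P⇔Q qx) ¬px

module _ {R : Rel A r} (R? : Decidable R) where

  inversions-∷ʳ : ∀ xs x → inversions R? (xs ∷ʳ x) ≡ inversions R? xs + length (filter (flip R? x) xs)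
  inversions-∷ʳ []       x = refl
  inversions-∷ʳ (y ∷ xs) x = begin
    length (filter (R? y) (xs ∷ʳ x)) + inversions R? (xs ∷ʳ x)
      ≡⟨ cong₂ _+_ (length-filter-++ (R? y) xs [ x ]) (inversions-∷ʳ xs x) ⟩
    (length (filter (R? y) xs) + length (filter (R? y) [ x ])) + (inversions R? xs + length (filter (flip R? x) xs))
      ≡⟨ interchange (length (filter (R? y) xs)) (length (filter (R? y) [ x ]))
                     (inversions R? xs) (length (filter (flip R? x) xs)) ⟩
    inversions R? (y ∷ xs) + (length (filter (R? y) [ x ]) + length (filter (flip R? x) xs))
      ≡⟨ cong (λ m → inversions R? (y ∷ xs) + (m + length (filter (flip R? x) xs))) singleton-flip ⟩
    inversions R? (y ∷ xs) + (length (filter (flip R? x) [ y ]) + length (filter (flip R? x) xs))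
      ≡⟨ cong (inversions R? (y ∷ xs) +_) (length-filter-++ (flip R? x) [ y ] xs) ⟨
    inversions R? (y ∷ xs) + length (filter (flip R? x) (y ∷ xs)) ∎
    where
    open ≡-Reasoning
    singleton-flip : length (filter (R? y) [ x ]) ≡ length (filter (flip R? x) [ y ])
    singleton-flip with R? y x
    ... | yes _ = refl
    ... | no _  = refl

  inversions-reverse : ∀ xs → inversions R? (reverse xs) ≡ inversions (flip R?) xs
  inversions-reverse []       = refl
  inversions-reverse (x ∷ xs) = begin
    inversions R? (reverse (x ∷ xs))
      ≡⟨ cong (inversions R?) (unfold-reverse x xs) ⟩
    inversions R? (reverse xs ∷ʳ x)
      ≡⟨ inversions-∷ʳ (reverse xs) x ⟩
    inversions R? (reverse xs) + length (filter (flip R? x) (reverse xs))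
      ≡⟨ cong₂ _+_ (inversions-reverse xs) (length-filter-reverse (flip R? x) xs) ⟩
    inversions (flip R?) xs + length (filter (flip R? x) xs)
      ≡⟨ +-comm (inversions (flip R?) xs) _ ⟩
    inversions (flip R?) (x ∷ xs) ∎
    where open ≡-Reasoning

  inversions-cong : {R′ : Rel A s} (R′? : Decidable R′) {Q : Pred A q} → ∀ {xs} → All Q xs →
    (∀ {x y} → Q x → Q y → R x y ⇔ R′ x y) → inversions R? xs ≡ inversions R′? xs
  inversions-cong R′? []         R⇔R′ = refl
  inversions-cong R′? (qx ∷ qxs) R⇔R′ =
    cong₂ _+_ (length-filter-cong (R? _) (R′? _) (All.map (R⇔R′ qx) qxs)) (inversions-cong R′? qxs R⇔R′)

module _ {P : Pred A p} (P? : Decidable₁ P) {R : Rel A r} (R? : Decidable R)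
         {S : Rel Bool s} (S? : Decidable S) (¬S[f,f] : ¬ S false false)
         (R⇔S : ∀ {x y} → P x ⊎ P y → R x y ⇔ S (does (P? x)) (does (P? y))) where

  private
    R⇔S-onʳ : ∀ {x y} → ¬ P x → P y → R x y ⇔ S false true
    R⇔S-onʳ {x} {y} ¬px py with P? x | P? y | R⇔S {x} {y} (inj₂ py)
    ... | no _   | yes _  | R⇔S[x,y] = R⇔S[x,y]
    ... | yes px | _      | _        = contradiction px ¬px
    ... | no _   | no ¬py | _        = contradiction py ¬py

    R⇔S-onˡ : ∀ {x y} → P x → R x y ⇔ S true (does (P? y))
    R⇔S-onˡ {x} {y} px with P? x | R⇔S {x} {y} (inj₁ px)
    ... | yes _  | R⇔S[x,y] = R⇔S[x,y]
    ... | no ¬px | _        = contradiction px ¬px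

    length-filter-split : ∀ {x} → ¬ P x → ∀ ys → length (filter (R? x) ys) ≡
      length (filter (R? x) (filter (¬? ∘ P?) ys)) + length (filter (S? false) (marks P? ys))
    length-filter-split ¬px []       = refl
    length-filter-split {x} ¬px (y ∷ ys) with P? y
    ... | yes py with R? x y | S? false true
    ...   | yes _   | yes _  = trans (cong suc (length-filter-split ¬px ys)) (sym (+-suc _ _))
    ...   | no _    | no _   = length-filter-split ¬px ys
    ...   | yes rxy | no ¬s  = contradiction (to (R⇔S-onʳ ¬px py) rxy) ¬s
    ...   | no ¬rxy | yes s  = contradiction (from (R⇔S-onʳ ¬px py) s) ¬rxy
    length-filter-split {x} ¬px (y ∷ ys) | no ¬py with R? x y | S? false false
    ...   | _     | yes s = contradiction s ¬S[f,f]
    ...   | yes _ | no _  = cong suc (length-filter-split ¬px ys)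
    ...   | no _  | no _  = length-filter-split ¬px ys

  inversions-split : ∀ xs → inversions R? xs ≡ inversions R? (filter (¬? ∘ P?) xs) + inversions S? (marks P? xs)
  inversions-split []       = refl
  inversions-split (x ∷ xs) with P? x
  ... | yes px = begin
    length (filter (R? x) xs) + inversions R? xs
      ≡⟨ cong₂ _+_ count-by-marks (inversions-split xs) ⟩
    length (filter (S? true) (marks P? xs)) + (inversions R? (filter (¬? ∘ P?) xs) + inversions S? (marks P? xs))
      ≡⟨ x∙yz≈y∙xz (length (filter (S? true) (marks P? xs))) (inversions R? (filter (¬? ∘ P?) xs))
                   (inversions S? (marks P? xs)) ⟩
    inversions R? (filter (¬? ∘ P?) xs) + inversions S? (true ∷ marks P? xs) ∎
    where
    open ≡-Reasoning
    count-by-marks : length (filter (R? x) xs) ≡ length (filter (S? true) (marks P? xs))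
    count-by-marks = trans
      (cong length (filter-≐ (R? x) (S? true ∘ does ∘ P?) (to (R⇔S-onˡ px) , from (R⇔S-onˡ px)) xs))
      (sym (length-filter-map (S? true) xs))
  ... | no ¬px = begin
    length (filter (R? x) xs) + inversions R? xs
      ≡⟨ cong₂ _+_ (length-filter-split ¬px xs) (inversions-split xs) ⟩
    (length (filter (R? x) (filter (¬? ∘ P?) xs)) + length (filter (S? false) (marks P? xs)))
      + (inversions R? (filter (¬? ∘ P?) xs) + inversions S? (marks P? xs))
      ≡⟨ interchange (length (filter (R? x) (filter (¬? ∘ P?) xs))) (length (filter (S? false) (marks P? xs)))
                     (inversions R? (filter (¬? ∘ P?) xs)) (inversions S? (marks P? xs)) ⟩
    inversions R? (x ∷ filter (¬? ∘ P?) xs) + inversions S? (false ∷ marks P? xs) ∎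
    where open ≡-Reasoning

count-cong : ∀ {n} {P Q : Fin n → Set} (P? : Decidable₁ P) (Q? : Decidable₁ Q) →
  (∀ i → P i ⇔ Q i) → count P? ≡ count Q?
count-cong {zero}  P? Q? P⇔Q = refl
count-cong {suc n} P? Q? P⇔Q with P? Fin.zero | Q? Fin.zero
... | yes _ | yes _ = cong suc (count-cong (P? ∘ Fin.suc) (Q? ∘ Fin.suc) (P⇔Q ∘ Fin.suc))
... | no _  | no _  = count-cong (P? ∘ Fin.suc) (Q? ∘ Fin.suc) (P⇔Q ∘ Fin.suc)
... | yes p | no ¬q = contradiction (to (P⇔Q Fin.zero) p) ¬q
... | no ¬p | yes q = contradiction (from (P⇔Q Fin.zero) q) ¬p

count-tail : ∀ {n} {P : Fin (suc n) → Set} {Q : Fin n → Set} (P? : Decidable₁ P) (Q? : Decidable₁ Q) →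
  ¬ P Fin.zero → (∀ i → P (Fin.suc i) ⇔ Q i) → count P? ≡ count Q?
count-tail P? Q? ¬p₀ P⇔Q with P? Fin.zero
... | yes p₀ = contradiction p₀ ¬p₀
... | no _   = count-cong (P? ∘ Fin.suc) Q? P⇔Q

count-lookup : ∀ {n} {P : Pred A 0ℓ} (P? : Decidable₁ P) (v : Vec A n) →
  count (P? ∘ lookup v) ≡ length (filter P? (toList v))
count-lookup P? Vec.[]      = refl
count-lookup P? (x Vec.∷ v) with P? x
... | yes _ = cong suc (count-lookup P? v)
... | no _  = count-lookup P? v

sumFin-cong : ∀ {n} {f g : Fin n → ℕ} → (∀ i → f i ≡ g i) → sumFin f ≡ sumFin g
sumFin-cong {zero}  f≗g = refl
sumFin-cong {suc n} f≗g = cong₂ _+_ (f≗g Fin.zero) (sumFin-cong (f≗g ∘ Fin.suc))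

inversionsFrom : ∀ {n} {R : Rel A 0ℓ} → Decidable R → Vec A n → Fin n → ℕ
inversionsFrom R? v i = count (λ j → (i <ᶠ? j) ×-dec R? (lookup v i) (lookup v j))

sumFin-inversionsFrom : ∀ {n} {R : Rel A 0ℓ} (R? : Decidable R) (v : Vec A n) →
  sumFin (inversionsFrom R? v) ≡ inversions R? (toList v)
sumFin-inversionsFrom R? Vec.[] = refl
sumFin-inversionsFrom {n = suc n} R? (x Vec.∷ v) =
  cong₂ _+_ from-head (trans (sumFin-cong from-tail) (sumFin-inversionsFrom R? v))
  where
  from-head : inversionsFrom R? (x Vec.∷ v) Fin.zero ≡ length (filter (R? x) (toList v))
  from-head = trans
    (count-tail (λ j → (Fin.zero {n} <ᶠ? j) ×-dec R? x (lookup (x Vec.∷ v) j)) (R? x ∘ lookup v)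
                (λ { (() , _) }) (λ _ → mk⇔ proj₂ (s≤s z≤n ,_)))
    (count-lookup (R? x) v)
  from-tail : ∀ i → inversionsFrom R? (x Vec.∷ v) (Fin.suc i) ≡ inversionsFrom R? v i
  from-tail i = count-tail (λ j → (Fin.suc i <ᶠ? j) ×-dec R? (lookup v i) (lookup (x Vec.∷ v) j))
                           (λ j → (i <ᶠ? j) ×-dec R? (lookup v i) (lookup v j)) (λ { (() , _) })
    (λ _ → mk⇔ (λ { (s≤s i<j , r) → i<j , r }) (λ { (i<j , r) → s≤s i<j , r }))

¬KInvPair-sucˡ : ∀ k {b} → ¬ KInvPair k (suc k) b
¬KInvPair-sucˡ k (inj₁ (1+k≤k , _))           = 1+n≰n 1+k≤k
¬KInvPair-sucˡ k (inj₂ (inj₁ (b<1+k , k<b))) = n≮n k (<-≤-trans k<b (m<1+n⇒m≤n b<1+k))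
¬KInvPair-sucˡ k (inj₂ (inj₂ (_ , 1+k≤k)))    = 1+n≰n 1+k≤k

KInvPair-sucʳ : ∀ k {a} → a ≢ suc k → KInvPair k a (suc k)
KInvPair-sucʳ k {a} a≢1+k with a ≤? k
... | yes a≤k = inj₂ (inj₂ (n<1+n k , a≤k))
... | no a≰k  = inj₂ (inj₁ (≤∧≢⇒< (≰⇒> a≰k) (≢-sym a≢1+k) , n<1+n k))

¬KInvPair-selfʳ : ∀ j {a} → ¬ KInvPair j a j
¬KInvPair-selfʳ j (inj₁ (a≤j , j<a))      = <⇒≱ j<a a≤j
¬KInvPair-selfʳ j (inj₂ (inj₁ (_ , j<j))) = n≮n j j<j
¬KInvPair-selfʳ j (inj₂ (inj₂ (j<j , _))) = n≮n j j<j

KInvPair-selfˡ : ∀ j {b} → b ≢ j → KInvPair j j b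
KInvPair-selfˡ j {b} b≢j with <-cmp b j
... | tri< b<j _ _ = inj₁ (≤-refl , b<j)
... | tri≈ _ b≡j _ = contradiction b≡j b≢j
... | tri> _ _ j<b = inj₂ (inj₂ (j<b , ≤-refl))

KInvPair⇔KInvPair-suc : ∀ k {a b} → a ≢ suc k → b ≢ suc k → KInvPair k a b ⇔ KInvPair (suc k) a b
KInvPair⇔KInvPair-suc k a≢1+k b≢1+k = mk⇔ to′ from′
  where
  below : ∀ {m} → m ≢ suc k → m ≤ suc k → m ≤ k
  below m≢1+k m≤1+k = m<1+n⇒m≤n (≤∧≢⇒< m≤1+k m≢1+k)
  to′ : KInvPair k _ _ → KInvPair (suc k) _ _
  to′ (inj₁ (a≤k , b<a))        = inj₁ (m≤n⇒m≤1+n a≤k , b<a)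
  to′ (inj₂ (inj₁ (b<a , k<b))) = inj₂ (inj₁ (b<a , ≤∧≢⇒< k<b (≢-sym b≢1+k)))
  to′ (inj₂ (inj₂ (k<b , a≤k))) = inj₂ (inj₂ (≤∧≢⇒< k<b (≢-sym b≢1+k) , m≤n⇒m≤1+n a≤k))
  from′ : KInvPair (suc k) _ _ → KInvPair k _ _
  from′ (inj₁ (a≤1+k , b<a))          = inj₁ (below a≢1+k a≤1+k , b<a)
  from′ (inj₂ (inj₁ (b<a , 1+k<b)))   = inj₂ (inj₁ (b<a , <⇒≤ 1+k<b))
  from′ (inj₂ (inj₂ (1+k<b , a≤1+k))) = inj₂ (inj₂ (<⇒≤ 1+k<b , below a≢1+k a≤1+k))

-- does (a ≟ c) computes to a ≡ᵇ c, out of reach of with-abstraction; hence the rewrites.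
KInvPair⇔mark< : ∀ k {a b} → a ≡ suc k ⊎ b ≡ suc k →
  KInvPair k a b ⇔ (does (a ≟ suc k) Bool.< does (b ≟ suc k))
KInvPair⇔mark< k {a} {b} a∨b≡1+k with a ≟ suc k | b ≟ suc k
... | yes refl | _ rewrite dec-true (suc k ≟ suc k) refl
  = mk⇔ (⊥-elim ∘ ¬KInvPair-sucˡ k) (λ ())
... | no a≢1+k | yes refl rewrite dec-false (a ≟ suc k) a≢1+k | dec-true (suc k ≟ suc k) refl
  = mk⇔ (λ _ → Bool.f<t) (λ _ → KInvPair-sucʳ k a≢1+k)
... | no a≢1+k | no b≢1+k = contradiction a∨b≡1+k [ a≢1+k , b≢1+k ]′

KInvPair⇔mark> : ∀ j {a b} → a ≡ j ⊎ b ≡ j →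
  KInvPair j a b ⇔ (does (b ≟ j) Bool.< does (a ≟ j))
KInvPair⇔mark> j {a} {b} a∨b≡j with a ≟ j | b ≟ j
... | _        | yes refl rewrite dec-true (j ≟ j) refl
  = mk⇔ (⊥-elim ∘ ¬KInvPair-selfʳ j) (λ ())
... | yes refl | no b≢j rewrite dec-false (b ≟ j) b≢j | dec-true (j ≟ j) refl
  = mk⇔ (λ _ → Bool.f<t) (λ _ → KInvPair-selfˡ j b≢j)
... | no a≢j   | no b≢j = contradiction a∨b≡j [ a≢j , b≢j ]′

others : ℕ → List ℕ → List ℕ
others c = filter (¬? ∘ (_≟ c))

occurrences : ℕ → List ℕ → List Bool
occurrences c = marks (_≟ c)

-- The filling function behind B is private to Defs; the meta below is solved by unification
-- with it, which names it here and lets B be unfolded to it.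
mutual
  fill : ℕ → ∀ {n} → Vec ℕ n → List ℕ → Vec ℕ n
  fill = _

  B≡fill : ∀ c {n} (w : Word n) → B c w ≡ fill c (Vec.reverse w) (others c (toList w))
  B≡fill c w with Vec.reverse w | others c (toList w)
  ... | v | r = refl

module _ (c : ℕ) where

  private
    others-c∷ : ∀ xs → others c (c ∷ xs) ≡ others c xs
    others-c∷ xs = filter-reject (¬? ∘ (_≟ c)) (λ c≢c → c≢c refl)

    others-∷ : ∀ {x} xs → x ≢ c → others c (x ∷ xs) ≡ x ∷ others c xs
    others-∷ xs x≢c = filter-accept (¬? ∘ (_≟ c)) x≢c

  others-fill : ∀ {n} (v : Vec ℕ n) {r} → All (_≢ c) r → length r ≡ length (others c (toList v)) →
    others c (toList (fill c v r)) ≡ r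
  others-fill Vec.[] {[]}    _ _  = refl
  others-fill Vec.[] {_ ∷ _} _ ()
  others-fill (x Vec.∷ v) {r} r≢c len with x ≟ c
  ... | yes refl = trans (others-c∷ _) (others-fill v r≢c (trans len (cong length (others-c∷ (toList v)))))
  ... | no x≢c with r | r≢c
  ...   | []     | _          = contradiction (trans len (cong length (others-∷ (toList v) x≢c))) (λ ())
  ...   | y ∷ r′ | y≢c ∷ r′≢c = trans (others-∷ _ y≢c)
    (cong (y ∷_) (others-fill v r′≢c (suc-injective (trans len (cong length (others-∷ (toList v) x≢c))))))

  occurrences-fill : ∀ {n} (v : Vec ℕ n) {r} → All (_≢ c) r → length r ≡ length (others c (toList v)) →
    occurrences c (toList (fill c v r)) ≡ occurrences c (toList v)
  occurrences-fill Vec.[] _ _ = refl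
  occurrences-fill (x Vec.∷ v) {r} r≢c len with x ≟ c
  ... | yes refl = cong (does (c ≟ c) ∷_)
    (occurrences-fill v r≢c (trans len (cong length (others-c∷ (toList v)))))
  ... | no x≢c with r | r≢c
  ...   | []     | _          = contradiction (trans len (cong length (others-∷ (toList v) x≢c))) (λ ())
  ...   | y ∷ r′ | y≢c ∷ r′≢c = cong₂ _∷_ (trans (dec-false (y ≟ c) y≢c) (sym (dec-false (x ≟ c) x≢c)))
    (occurrences-fill v r′≢c (suc-injective (trans len (cong length (others-∷ (toList v) x≢c)))))

  private
    length-others-reverse : ∀ {n} (w : Vec ℕ n) →
      length (others c (toList w)) ≡ length (others c (toList (Vec.reverse w)))
    length-others-reverse w = trans (sym (length-filter-reverse (¬? ∘ (_≟ c)) (toList w)))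
                                    (cong (length ∘ others c) (sym (toList-reverse w)))

  others-B : ∀ {n} (w : Word n) → others c (toList (B c w)) ≡ others c (toList w)
  others-B w = trans (cong (others c ∘ toList) (B≡fill c w))
    (others-fill (Vec.reverse w) (all-filter (¬? ∘ (_≟ c)) (toList w)) (length-others-reverse w))

  occurrences-B : ∀ {n} (w : Word n) → occurrences c (toList (B c w)) ≡ reverse (occurrences c (toList w))
  occurrences-B w = begin
    occurrences c (toList (B c w))
      ≡⟨ cong (occurrences c ∘ toList) (B≡fill c w) ⟩
    occurrences c (toList (fill c (Vec.reverse w) (others c (toList w))))
      ≡⟨ occurrences-fill (Vec.reverse w) (all-filter (¬? ∘ (_≟ c)) (toList w)) (length-others-reverse w) ⟩
    occurrences c (toList (Vec.reverse w))
      ≡⟨ cong (occurrences c) (toList-reverse w) ⟩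
    occurrences c (reverse (toList w))
      ≡⟨ reverse-map (does ∘ (_≟ c)) (toList w) ⟩
    reverse (occurrences c (toList w)) ∎
    where open ≡-Reasoning

mainTheorem1 : (n : ℕ) → n ≥ 1 → (w : Word n) → IsPositiveWord w → (k : ℕ) →
    inv k w ≡ inv (suc k) (B (suc k) w)
mainTheorem1 n _ w _ k = begin
  inv k w
    ≡⟨ sumFin-inversionsFrom (kInvPair? k) w ⟩
  inversions (kInvPair? k) xs
    ≡⟨ inversions-split (_≟ c) (kInvPair? k) Bool._<?_ (λ ()) (KInvPair⇔mark< k) xs ⟩
  inversions (kInvPair? k) (others c xs) + inversions Bool._<?_ (occurrences c xs)
    ≡⟨ cong₂ _+_ (inversions-cong (kInvPair? k) (kInvPair? c) (all-filter (¬? ∘ (_≟ c)) xs) (KInvPair⇔KInvPair-suc k))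
                 (sym (inversions-reverse (flip Bool._<?_) (occurrences c xs))) ⟩
  inversions (kInvPair? c) (others c xs) + inversions (flip Bool._<?_) (reverse (occurrences c xs))
    ≡⟨ cong₂ _+_ (cong (inversions (kInvPair? c)) (others-B c w))
                 (cong (inversions (flip Bool._<?_)) (occurrences-B c w)) ⟨
  inversions (kInvPair? c) (others c ys) + inversions (flip Bool._<?_) (occurrences c ys)
    ≡⟨ inversions-split (_≟ c) (kInvPair? c) (flip Bool._<?_) (λ ()) (KInvPair⇔mark> c) ys ⟨
  inversions (kInvPair? c) ys
    ≡⟨ sumFin-inversionsFrom (kInvPair? c) (B c w) ⟨
  inv c (B c w) ∎
  where
  open ≡-Reasoning
  c = suc k
  xs = toList w
  ys = toList (B c w)
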